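{- Let $U$ be a $\lambda H$-term. Then $U$ is $I$-$t$-solvable if and only if $U$ is $J$-$t$-solvable.
   Context: $\lambda H$-terms are the $\lambda$-terms built from variables and one additional constant $H$ by abstraction and application. Application is left-associative. The head reduction step $\rightarrow_t$ is $\lambda\overline{x}\,((\lambda x\,A)\,B)\,W_1\ldots W_n\rightarrow_t\lambda\overline{x}\,A[B/x]\,W_1\ldots W_n$. The $I$-reduction is $\lambda\overline{x}\,H\,U_1\ldots U_n\rightarrow_I\lambda\overline{x}\,U_1\ldots U_n$ ($n\ge1$). The $J$-reduction is $\lambda\overline{x}\,H\,U_1U_2U_3\ldots U_n\rightarrow_J\lambda\overline{x}\,U_1\,(H\,U_2)\,U_3\ldots U_n$ for $n\ge2$, and $\lambda\overline{x}\,H\,U_1\rightarrow_J\lambda\overline{x}\,U_1$. A $\lambda H$-term is in head normal form if it has the form $\lambda\overline{x}\,H$ or $\lambda\overline{x}\,x\,V_1\ldots V_n$ with $x$ a variable. A $\lambda H$-term is $I$-$t$-solvable (resp. $J$-$t$-solvable) iff some finite sequence of $I$-reduction (resp. $J$-reduction) steps and $t$-reduction steps from it yields a head normal form. -}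

module Defs where

open import Data.Nat using (ℕ; zero; suc)
open import Data.Product using (Σ; _×_)
open import Data.Sum using (_⊎_)
open import Relation.Binary.Construct.Closure.ReflexiveTransitive using (Star)

-- λH-terms, with variables as de Bruijn indices (terms up to α-conversion).
data Term : Set where
  var : ℕ → Term
  H   : Term
  lam : Term → Term
  app : Term → Term → Term   -- app U V  =  U V  (application is left-associative)

ext : (ℕ → ℕ) → ℕ → ℕ
ext ρ zero    = zero
ext ρ (suc n) = suc (ρ n)

rename : (ℕ → ℕ) → Term → Term
rename ρ (var n)   = var (ρ n)
rename ρ H         = H
rename ρ (lam A)   = lam (rename (ext ρ) A)
rename ρ (app A B) = app (rename ρ A) (rename ρ B)

exts : (ℕ → Term) → ℕ → Term
exts σ zero    = var zero
exts σ (suc n) = rename suc (σ n)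

subst : (ℕ → Term) → Term → Term
subst σ (var n)   = σ n
subst σ H         = H
subst σ (lam A)   = lam (subst (exts σ) A)
subst σ (app A B) = app (subst σ A) (subst σ B)

-- A [ B ]  is  A[B/x]  where x is the variable bound by the enclosing λ of A.
sub0 : Term → ℕ → Term
sub0 B zero    = B
sub0 B (suc n) = var n

_[_] : Term → Term → Term
A [ B ] = subst (sub0 B) A

-- Reductions at the head of an application spine  (· W₁ … Wₙ), n ≥ 0.
data SpineT : Term → Term → Set where
  β    : ∀ {A B} → SpineT (app (lam A) B) (A [ B ])
  appL : ∀ {A A' W} → SpineT A A' → SpineT (app A W) (app A' W)

data SpineI : Term → Term → Set where
  dropH : ∀ {U} → SpineI (app H U) U
  appL  : ∀ {A A' W} → SpineI A A' → SpineI (app A W) (app A' W)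

data SpineJ : Term → Term → Set where
  swapH : ∀ {U₁ U₂} → SpineJ (app (app H U₁) U₂) (app U₁ (app H U₂))
  appL  : ∀ {A A' W} → SpineJ A A' → SpineJ (app A W) (app A' W)

-- λx̄ ((λx A) B) W₁…Wₙ →t λx̄ A[B/x] W₁…Wₙ
data _→t_ : Term → Term → Set where
  here : ∀ {A B} → SpineT A B → A →t B
  lam  : ∀ {A B} → A →t B → lam A →t lam B

-- λx̄ H U₁…Uₙ →I λx̄ U₁…Uₙ   (n ≥ 1)
data _→I_ : Term → Term → Set where
  here : ∀ {A B} → SpineI A B → A →I B
  lam  : ∀ {A B} → A →I B → lam A →I lam B

-- λx̄ H U₁U₂U₃…Uₙ →J λx̄ U₁ (H U₂) U₃…Uₙ  (n ≥ 2),  and  λx̄ H U₁ →J λx̄ U₁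
data _→J_ : Term → Term → Set where
  here : ∀ {A B} → SpineJ A B → A →J B
  one  : ∀ {U} → app H U →J U
  lam  : ∀ {A B} → A →J B → lam A →J lam B

data VarHead : Term → Set where
  var : ∀ n → VarHead (var n)
  app : ∀ {A V} → VarHead A → VarHead (app A V)

data HNF : Term → Set where
  hH   : HNF H
  hvar : ∀ {A} → VarHead A → HNF A
  lam  : ∀ {A} → HNF A → HNF (lam A)

_→It_ : Term → Term → Set
A →It B = (A →I B) ⊎ (A →t B)

_→Jt_ : Term → Term → Set
A →Jt B = (A →J B) ⊎ (A →t B)

I-t-solvable : Term → Set
I-t-solvable U = Σ Term (λ V → Star _→It_ U V × HNF V)

J-t-solvable : Term → Set
J-t-solvable U = Σ Term (λ V → Star _→Jt_ U V × HNF V)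

-- Write M ≼ N when N arises from M by replacing subterms U by H U. Under I-reduction H
-- acts as the identity, and the J-step H U₁ U₂ … → U₁ (H U₂) … is the I-step
-- H U₁ U₂ … → U₁ U₂ … up to one inserted H. So ≼ is a simulation: if M ≼ N, either M is
-- a head normal form and N J-t-reduces to one, or the I-t-step M → M' is matched by a
-- nonempty J-t-reduction N →⁺ N' with M' ≼ N'. Both reductions are deterministic, so a
-- run to head normal form from either side of U ≼ U can be followed through the simulation.
module Submission where

open import Defs
open import Data.Empty using (⊥-elim)
open import Data.Nat using (zero; suc)
open import Data.List using (List; []; _∷_; foldl)
open import Data.List.Relation.Binary.Pointwise using (Pointwise; []; _∷_)
open import Data.Product using (_×_; _,_)
open import Data.Sum using (_⊎_; inj₁; inj₂; [_,_]) renaming (map to ⊎-map)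
open import Relation.Binary.Construct.Closure.ReflexiveTransitive
  using (Star; ε; _◅_; _◅◅_; gmap)
open import Relation.Binary.PropositionalEquality using (_≡_; refl)
open import Relation.Binary.Rewriting using (Deterministic)
open import Relation.Nullary using (¬_)

infix 4 _≼_

data _≼_ : Term → Term → Set where
  var  : ∀ n → var n ≼ var n
  H    : H ≼ H
  lam  : ∀ {A B} → A ≼ B → lam A ≼ lam B
  app  : ∀ {A A' B B'} → A ≼ A' → B ≼ B' → app A B ≼ app A' B'
  insH : ∀ {M N} → M ≼ N → M ≼ app H N

≼-refl : ∀ M → M ≼ M
≼-refl (var n)   = var n
≼-refl H         = H
≼-refl (lam M)   = lam (≼-refl M)
≼-refl (app M N) = app (≼-refl M) (≼-refl N)

≼-rename : ∀ ρ {A A'} → A ≼ A' → rename ρ A ≼ rename ρ A'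
≼-rename ρ (var n)   = var (ρ n)
≼-rename ρ H         = H
≼-rename ρ (lam r)   = lam (≼-rename (ext ρ) r)
≼-rename ρ (app r s) = app (≼-rename ρ r) (≼-rename ρ s)
≼-rename ρ (insH r)  = insH (≼-rename ρ r)

≼-subst : ∀ {σ σ'} → (∀ n → σ n ≼ σ' n) → ∀ {A A'} → A ≼ A' → subst σ A ≼ subst σ' A'
≼-subst σ≼σ' (var n)   = σ≼σ' n
≼-subst σ≼σ' H         = H
≼-subst σ≼σ' (lam r)   = lam (≼-subst exts-≼ r)
  where
  exts-≼ : ∀ n → exts _ n ≼ exts _ n
  exts-≼ zero    = var zero
  exts-≼ (suc n) = ≼-rename suc (σ≼σ' n)
≼-subst σ≼σ' (app r s) = app (≼-subst σ≼σ' r) (≼-subst σ≼σ' s)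
≼-subst σ≼σ' (insH r)  = insH (≼-subst σ≼σ' r)

≼-[] : ∀ {A A' B B'} → A ≼ A' → B ≼ B' → A [ B ] ≼ A' [ B' ]
≼-[] r s = ≼-subst sub0-≼ r
  where
  sub0-≼ : ∀ n → sub0 _ n ≼ sub0 _ n
  sub0-≼ zero    = s
  sub0-≼ (suc n) = var n

infixl 5 _·_

_·_ : Term → List Term → Term
_·_ = foldl app

appL-· : {_⟶_ : Term → Term → Set} →
         (∀ {A A' W} → A ⟶ A' → app A W ⟶ app A' W) →
         ∀ Ws {A A'} → A ⟶ A' → (A · Ws) ⟶ (A' · Ws)
appL-· step-appL []       s = s
appL-· {_⟶_} step-appL (W ∷ Ws) s = appL-· {_⟶_} step-appL Ws (step-appL s)

dropH-· : ∀ {U} Ws → SpineI (app H U · Ws) (U · Ws)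
dropH-· Ws = appL-· {SpineI} appL Ws dropH

swapH-· : ∀ {U₁ U₂} Ws → SpineJ (app (app H U₁) U₂ · Ws) (app U₁ (app H U₂) · Ws)
swapH-· Ws = appL-· {SpineJ} appL Ws swapH

β-· : ∀ {A B} Ws → SpineT (app (lam A) B · Ws) (A [ B ] · Ws)
β-· Ws = appL-· {SpineT} appL Ws β

VarHead-· : ∀ {A} Ws → VarHead A → VarHead (A · Ws)
VarHead-· []       v = v
VarHead-· (_ ∷ Ws) v = VarHead-· Ws (app v)

≼-· : ∀ {A A' Vs Ws} → A ≼ A' → Pointwise _≼_ Vs Ws → A · Vs ≼ A' · Ws
≼-· r []       = r
≼-· r (v ∷ vs) = ≼-· (app r v) vs

data Progress (M N : Term) : Set where
  solved : HNF M → J-t-solvable N → Progress M N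
  step   : ∀ {M' N₁ N'} → M →It M' → N →Jt N₁ → Star _→Jt_ N₁ N' → M' ≼ N' →
           Progress M N

lam-progress : ∀ {M N} → Progress M N → Progress (lam M) (lam N)
lam-progress (solved h (N' , run , h')) =
  solved (lam h) (lam N' , gmap lam (⊎-map lam lam) run , lam h')
lam-progress (step s s₁ run r) =
  step (⊎-map lam lam s) (⊎-map lam lam s₁) (gmap lam (⊎-map lam lam) run) (lam r)

◅-progress : ∀ {M N N₀} → N →Jt N₀ → Progress M N₀ → Progress M N
◅-progress s (solved h (N' , run , h')) = solved h (N' , s ◅ run , h')
◅-progress s (step s' s₁ run r)         = step s' s (s₁ ◅ run) r

progress-· : ∀ {A A' Vs Ws} → A ≼ A' → Pointwise _≼_ Vs Ws → Progress (A · Vs) (A' · Ws)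
progress-· {Vs = Vs} {Ws} (var n) _ =
  solved (hvar (VarHead-· Vs (var n))) (_ , ε , hvar (VarHead-· Ws (var n)))
progress-· H [] = solved hH (H , ε , hH)
progress-· H (_∷_ {xs = Vs} v []) =
  step (inj₁ (here (dropH-· Vs))) (inj₁ one) ε v
progress-· H (_∷_ {xs = Vs} v (_∷_ {ys = Ws} v₂ vs)) =
  step (inj₁ (here (dropH-· Vs))) (inj₁ (here (swapH-· Ws))) ε
       (≼-· v (insH v₂ ∷ vs))
progress-· (lam r) [] = lam-progress (progress-· r [])
progress-· (lam r) (_∷_ {xs = Vs} {ys = Ws} v vs) =
  step (inj₂ (here (β-· Vs))) (inj₂ (here (β-· Ws))) ε
       (≼-· (≼-[] r v) vs)
progress-· (app r s) vs = progress-· r (s ∷ vs)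
progress-· (insH r) [] = ◅-progress (inj₁ one) (progress-· r [])
progress-· (insH r) (_∷_ {ys = Ws} v vs) =
  ◅-progress (inj₁ (here (swapH-· Ws))) (progress-· r (insH v ∷ vs))

progress : ∀ {M N} → M ≼ N → Progress M N
progress r = progress-· r []

SpineI-deterministic : Deterministic _≡_ SpineI
SpineI-deterministic dropH     dropH     = refl
SpineI-deterministic dropH     (appL ())
SpineI-deterministic (appL ()) dropH
SpineI-deterministic (appL s)  (appL t) with SpineI-deterministic s t
... | refl = refl

SpineT-deterministic : Deterministic _≡_ SpineT
SpineT-deterministic β         β         = refl
SpineT-deterministic β         (appL ())
SpineT-deterministic (appL ()) β
SpineT-deterministic (appL s)  (appL t) with SpineT-deterministic s t
... | refl = refl

SpineJ-deterministic : Deterministic _≡_ SpineJ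
SpineJ-deterministic swapH            swapH            = refl
SpineJ-deterministic swapH            (appL (appL ()))
SpineJ-deterministic (appL (appL ())) swapH
SpineJ-deterministic (appL s)         (appL t) with SpineJ-deterministic s t
... | refl = refl

SpineI-SpineT-disjoint : ∀ {A B C} → SpineI A B → ¬ SpineT A C
SpineI-SpineT-disjoint dropH     (appL ())
SpineI-SpineT-disjoint (appL ()) β
SpineI-SpineT-disjoint (appL s)  (appL t) = SpineI-SpineT-disjoint s t

SpineJ-SpineT-disjoint : ∀ {A B C} → SpineJ A B → ¬ SpineT A C
SpineJ-SpineT-disjoint swapH     (appL (appL ()))
SpineJ-SpineT-disjoint (appL ()) β
SpineJ-SpineT-disjoint (appL s)  (appL t) = SpineJ-SpineT-disjoint s t

→I-deterministic : Deterministic _≡_ _→I_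
→I-deterministic (here s)  (here t) = SpineI-deterministic s t
→I-deterministic (here ()) (lam t)
→I-deterministic (lam s)   (here ())
→I-deterministic (lam s)   (lam t) with →I-deterministic s t
... | refl = refl

→t-deterministic : Deterministic _≡_ _→t_
→t-deterministic (here s)  (here t) = SpineT-deterministic s t
→t-deterministic (here ()) (lam t)
→t-deterministic (lam s)   (here ())
→t-deterministic (lam s)   (lam t) with →t-deterministic s t
... | refl = refl

→J-deterministic : Deterministic _≡_ _→J_
→J-deterministic (here s)         (here t)         = SpineJ-deterministic s t
→J-deterministic one              one              = refl
→J-deterministic one              (here (appL ()))
→J-deterministic (here (appL ())) one
→J-deterministic (here ())        (lam t)
→J-deterministic (lam s)          (here ())
→J-deterministic (lam s)          (lam t) with →J-deterministic s t
... | refl = refl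

→I-→t-disjoint : ∀ {A B C} → A →I B → ¬ (A →t C)
→I-→t-disjoint (here s)  (here t) = SpineI-SpineT-disjoint s t
→I-→t-disjoint (here ()) (lam t)
→I-→t-disjoint (lam s)   (here ())
→I-→t-disjoint (lam s)   (lam t)  = →I-→t-disjoint s t

→J-→t-disjoint : ∀ {A B C} → A →J B → ¬ (A →t C)
→J-→t-disjoint (here s)  (here t)         = SpineJ-SpineT-disjoint s t
→J-→t-disjoint one       (here (appL ()))
→J-→t-disjoint (here ()) (lam t)
→J-→t-disjoint (lam s)   (here ())
→J-→t-disjoint (lam s)   (lam t)          = →J-→t-disjoint s t

⊎-deterministic : {A : Set} {_⟶₁_ _⟶₂_ : A → A → Set} →
                  Deterministic _≡_ _⟶₁_ → Deterministic _≡_ _⟶₂_ →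
                  (∀ {a b c} → a ⟶₁ b → ¬ (a ⟶₂ c)) →
                  Deterministic _≡_ (λ a b → a ⟶₁ b ⊎ a ⟶₂ b)
⊎-deterministic det₁ det₂ disj (inj₁ s) (inj₁ t) = det₁ s t
⊎-deterministic det₁ det₂ disj (inj₁ s) (inj₂ t) = ⊥-elim (disj s t)
⊎-deterministic det₁ det₂ disj (inj₂ s) (inj₁ t) = ⊥-elim (disj t s)
⊎-deterministic det₁ det₂ disj (inj₂ s) (inj₂ t) = det₂ s t

→It-deterministic : Deterministic _≡_ _→It_
→It-deterministic =
  ⊎-deterministic {_⟶₁_ = _→I_} {_→t_} →I-deterministic →t-deterministic →I-→t-disjoint

→Jt-deterministic : Deterministic _≡_ _→Jt_
→Jt-deterministic =
  ⊎-deterministic {_⟶₁_ = _→J_} {_→t_} →J-deterministic →t-deterministic →J-→t-disjoint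

VarHead-¬SpineI : ∀ {A B} → VarHead A → ¬ SpineI A B
VarHead-¬SpineI (app ()) dropH
VarHead-¬SpineI (app v)  (appL s) = VarHead-¬SpineI v s

VarHead-¬SpineT : ∀ {A B} → VarHead A → ¬ SpineT A B
VarHead-¬SpineT (app ()) β
VarHead-¬SpineT (app v)  (appL s) = VarHead-¬SpineT v s

VarHead-¬SpineJ : ∀ {A B} → VarHead A → ¬ SpineJ A B
VarHead-¬SpineJ (app (app ())) swapH
VarHead-¬SpineJ (app v)        (appL s) = VarHead-¬SpineJ v s

HNF-¬→I : ∀ {A B} → HNF A → ¬ (A →I B)
HNF-¬→I hH        (here ())
HNF-¬→I (hvar v)  (here s) = VarHead-¬SpineI v s
HNF-¬→I (hvar ()) (lam s)
HNF-¬→I (lam h)   (here ())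
HNF-¬→I (lam h)   (lam s)  = HNF-¬→I h s

HNF-¬→t : ∀ {A B} → HNF A → ¬ (A →t B)
HNF-¬→t hH        (here ())
HNF-¬→t (hvar v)  (here s) = VarHead-¬SpineT v s
HNF-¬→t (hvar ()) (lam s)
HNF-¬→t (lam h)   (here ())
HNF-¬→t (lam h)   (lam s)  = HNF-¬→t h s

HNF-¬→J : ∀ {A B} → HNF A → ¬ (A →J B)
HNF-¬→J hH              (here ())
HNF-¬→J (hvar v)        (here s) = VarHead-¬SpineJ v s
HNF-¬→J (hvar (app ())) one
HNF-¬→J (hvar ())       (lam s)
HNF-¬→J (lam h)         (here ())
HNF-¬→J (lam h)         (lam s)  = HNF-¬→J h s

HNF-¬→It : ∀ {A B} → HNF A → ¬ (A →It B)
HNF-¬→It h = [ HNF-¬→I h , HNF-¬→t h ]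

HNF-¬→Jt : ∀ {A B} → HNF A → ¬ (A →Jt B)
HNF-¬→Jt h = [ HNF-¬→J h , HNF-¬→t h ]

I-t-run⇒J-t-solvable : ∀ {M V N} → Star _→It_ M V → HNF V → M ≼ N → J-t-solvable N
I-t-run⇒J-t-solvable ε hv r with progress r
... | solved _ solvable = solvable
... | step s _ _ _      = ⊥-elim (HNF-¬→It hv s)
I-t-run⇒J-t-solvable (s ◅ run) hv r with progress r
... | solved h _ = ⊥-elim (HNF-¬→It h s)
... | step s' s₁ run₁ r' with →It-deterministic s s'
...   | refl with I-t-run⇒J-t-solvable run hv r'
...     | V' , run' , hv' = V' , s₁ ◅ run₁ ◅◅ run' , hv'

-- Terminates because every simulated I-t-step consumes at least one step of the
-- (unique) J-t-run to head normal form.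
mutual
  J-t-run⇒I-t-solvable : ∀ {M N V} → Star _→Jt_ N V → HNF V → M ≼ N → I-t-solvable M
  J-t-run⇒I-t-solvable {M} run hv r with progress r
  ... | solved h _ = M , ε , h
  ... | step s s₁ run₁ r' with J-t-run-after⇒I-t-solvable run hv s₁ run₁ r'
  ...   | V , run' , hv' = V , s ◅ run' , hv'

  J-t-run-after⇒I-t-solvable : ∀ {M N N₁ N' V} → Star _→Jt_ N V → HNF V →
                               N →Jt N₁ → Star _→Jt_ N₁ N' → M ≼ N' → I-t-solvable M
  J-t-run-after⇒I-t-solvable ε hv s _ _ = ⊥-elim (HNF-¬→Jt hv s)
  J-t-run-after⇒I-t-solvable (s' ◅ run) hv s run₁ r with →Jt-deterministic s s'
  ... | refl with run₁
  ...   | ε          = J-t-run⇒I-t-solvable run hv r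
  ...   | s₁ ◅ run₁' = J-t-run-after⇒I-t-solvable run hv s₁ run₁' r

lemma3p15 : (U : Term) →
    (I-t-solvable U → J-t-solvable U) × (J-t-solvable U → I-t-solvable U)
lemma3p15 U =
  (λ (_ , run , hv) → I-t-run⇒J-t-solvable run hv (≼-refl U)) ,
  (λ (_ , run , hv) → J-t-run⇒I-t-solvable run hv (≼-refl U))
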